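{- Every affine sequence $\mathbf{c}$ contains (as a consecutive subsequence) one of the following sequences or the reverse of one of them: \[(1,2,2),(1,2,3),(1,2,4),(2,1,3),(2,1,4),(2,1,5),(3,1,4),(3,1,5),(1,3,1,3),\] \[(1,3,2),(1,3,3),(1,4,1,4),(2,1,6),(2,2,2,2),(3,1,6).\]
   Context: Quiddity cycles: consider finite sequences in $\mathbb{N}_0^n$ ($n\ge1$) up to the dihedral action on positions (rotations and reversal); write $(\!(c_1,\dots,c_n)\!)$ for the class, whose elements are representatives. The set of quiddity cycles is the smallest set of such classes containing $(\!(0,0)\!)$ and such that $(\!(c_1,\dots,c_n)\!)$ in it implies $(\!(c_1+1,1,c_2+1,c_3,\dots,c_n)\!)$ in it. An affine sequence is a bi-infinite integer sequence $\mathbf{c}$ for which there exist representatives of quiddity cycles $\mathbf{c}'_k=(c'_{k,1},\dots,c'_{k,r_k})$, $r_k\ge2$, $k\in\mathbb{Z}$, such that $\mathbf{c}$ is obtained by concatenating the blocks $\mathbf{c}'_k$ in order of $k$, where for each $k$ the last entry of block $k-1$ and the first entry of block $k$ are merged into the single entry $c'_{k-1,r_{k-1}}+2+c'_{k,1}$; i.e. $\mathbf{c}=(\dots,c'_{k-1,r_{k-1}}+2+c'_{k,1},c'_{k,2},\dots,c'_{k,r_k-1},c'_{k,r_k}+2+c'_{k+1,1},c'_{k+1,2},\dots)$. -}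

module Defs where

open import Data.Nat using (ℕ; zero; suc; _+_)
open import Data.Integer using (ℤ; +_) renaming (_+_ to _+ℤ_; suc to sucℤ; pred to predℤ)
open import Data.List using (List; []; _∷_; _++_; [_]; reverse; length; lookup)
open import Data.Fin using (Fin; toℕ)
open import Data.Product using (Σ; _×_; ∃)
open import Data.Sum using (_⊎_)
open import Relation.Binary.PropositionalEquality using (_≡_)

data QuiddityCycle : List ℕ → Set where
  base   : QuiddityCycle (0 ∷ 0 ∷ [])
  step   : ∀ c₁ c₂ rest → QuiddityCycle (c₁ ∷ c₂ ∷ rest)
         → QuiddityCycle (suc c₁ ∷ 1 ∷ suc c₂ ∷ rest)
  rotate : ∀ x xs → QuiddityCycle (x ∷ xs) → QuiddityCycle (xs ++ [ x ])
  rev    : ∀ xs → QuiddityCycle xs → QuiddityCycle (reverse xs)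

-- A block (first , middle , last) stands for the representative
-- first ∷ middle ++ [ last ], of length r = length middle + 2 ≥ 2.
record Block : Set where
  constructor block
  field
    first  : ℕ
    middle : List ℕ
    final  : ℕ

open Block public

blockList : Block → List ℕ
blockList b = first b ∷ (middle b ++ [ final b ])

-- c is affine: there are blocks b k (quiddity cycle representatives of length ≥ 2)
-- and start positions p k with p (k+1) = p k + (r_k - 1), such that
-- c (p k) = last(b (k-1)) + 2 + first(b k) and the inner entries of block k
-- occupy positions p k + 1, ..., p k + r_k - 2.
record AffineWitness (c : ℤ → ℤ) : Set where
  field
    blk      : ℤ → Block
    pos      : ℤ → ℤ
    isQC     : ∀ k → QuiddityCycle (blockList (blk k))
    posStep  : ∀ k → pos (sucℤ k) ≡ pos k +ℤ + suc (length (middle (blk k)))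
    junction : ∀ k → c (pos k) ≡ + (final (blk (predℤ k)) + 2 + first (blk k))
    inner    : ∀ k (i : Fin (length (middle (blk k))))
             → c (pos k +ℤ + suc (toℕ i)) ≡ + lookup (middle (blk k)) i

Affine : (ℤ → ℤ) → Set
Affine c = AffineWitness c

ContainsAt : (ℤ → ℤ) → List ℕ → ℤ → Set
ContainsAt c w i = ∀ (j : Fin (length w)) → c (i +ℤ + toℕ j) ≡ + lookup w j

Contains : (ℤ → ℤ) → List ℕ → Set
Contains c w = ∃ λ i → ContainsAt c w i

patterns : List (List ℕ)
patterns =
  (1 ∷ 2 ∷ 2 ∷ []) ∷ (1 ∷ 2 ∷ 3 ∷ []) ∷ (1 ∷ 2 ∷ 4 ∷ []) ∷ (2 ∷ 1 ∷ 3 ∷ []) ∷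
  (2 ∷ 1 ∷ 4 ∷ []) ∷ (2 ∷ 1 ∷ 5 ∷ []) ∷ (3 ∷ 1 ∷ 4 ∷ []) ∷ (3 ∷ 1 ∷ 5 ∷ []) ∷
  (1 ∷ 3 ∷ 1 ∷ 3 ∷ []) ∷
  (1 ∷ 3 ∷ 2 ∷ []) ∷ (1 ∷ 3 ∷ 3 ∷ []) ∷ (1 ∷ 4 ∷ 1 ∷ 4 ∷ []) ∷ (2 ∷ 1 ∷ 6 ∷ []) ∷
  (2 ∷ 2 ∷ 2 ∷ 2 ∷ []) ∷ (3 ∷ 1 ∷ 6 ∷ []) ∷ []

module Submission where

-- Quiddity cycles are quiddities of triangulated polygons, i.e.
-- of binary trees: a leaf is the degenerate 2-gon (0,0), and a node glues a
-- triangle onto the marked edge of the polygon with its two subpolygons on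
-- the other two sides.  We show that every representative of a quiddity cycle
-- is the quiddity of some tree, since the tree operations graft, mirror and
-- re-rooting realise the defining step, reversal and rotation.  By induction
-- on trees, a tree is either one of five small trees or the inner entries of
-- its quiddity already contain a pattern (the base case is a finite check).
-- In an affine sequence c, five consecutive blocks together with their four
-- junctions form a window read off c; if one block is not small the window
-- inherits its pattern, and if all five are small a finite check over the
-- 5^5 possibilities finds a pattern.

open import Defs
open import Data.Nat using (ℕ; zero; suc; _+_; _≟_)
open import Data.Nat.Properties using (+-suc; +-comm; +-identityʳ)
open import Data.Integer using (ℤ; +_; 0ℤ; 1ℤ) renaming (_+_ to _+ℤ_; suc to sucℤ)
import Data.Integer.Properties as ℤ
open import Data.List using (List; []; _∷_; _++_; [_]; reverse; length; lookup; map)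
open import Data.List.Properties using (++-assoc; ∷-injective; ∷ʳ-injective; reverse-++; unfold-reverse; reverse-involutive)
open import Data.List.Membership.Propositional using (_∈_; find)
open import Data.List.Membership.Propositional.Properties using (∈-map⁺)
open import Data.List.Membership.DecPropositional using (_∈?_)
open import Data.List.Relation.Unary.All as All using (All; []; _∷_; all?)
open import Data.List.Relation.Unary.Any as Any using (Any; here; any?)
open import Data.List.Relation.Binary.Prefix.Heterogeneous using (Prefix; []; _∷_)
open import Data.List.Relation.Binary.Infix.Heterogeneous using (Infix; here; there; _++ⁱ_; _ⁱ++_)
open import Data.List.Relation.Binary.Infix.Heterogeneous.Properties using (infix?)
open import Data.Fin using (Fin; toℕ) renaming (zero to fzero; suc to fsuc)
open import Data.Product using (Σ; _×_; _,_; proj₁; proj₂)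
open import Data.Sum using (_⊎_; inj₁; inj₂; map₁) renaming (map to map⊎)
open import Data.Unit using (⊤; tt)
open import Relation.Binary.Definitions using (DecidableEquality)
open import Relation.Nullary.Decidable using (Dec; yes; no; map′; _⊎-dec_; _×-dec_; from-yes)
open import Relation.Binary.PropositionalEquality using (_≡_; refl; sym; trans; cong; cong₂; subst; module ≡-Reasoning)

-- Binary trees, read as triangulated polygons with a marked edge.
data Tree : Set where
  leaf : Tree
  node : Tree → Tree → Tree

-- Number of triangles at the left and right end of the marked edge.
leftArm : Tree → ℕ
leftArm leaf       = 0
leftArm (node A B) = suc (leftArm A)

rightArm : Tree → ℕ
rightArm leaf       = 0
rightArm (node A B) = suc (rightArm B)

-- Triangle counts at the remaining vertices, from left to right; at the apex
-- of the root triangle the counts of both subpolygons and the triangle add up.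
inner : Tree → List ℕ
inner leaf       = []
inner (node A B) = inner A ++ (rightArm A + suc (leftArm B)) ∷ inner B

tailQ : Tree → List ℕ
tailQ t = inner t ++ [ rightArm t ]

quiddity : Tree → List ℕ
quiddity t = leftArm t ∷ tailQ t

mirror : Tree → Tree
mirror leaf       = leaf
mirror (node A B) = node (mirror B) (mirror A)

leftArm-mirror : ∀ t → leftArm (mirror t) ≡ rightArm t
leftArm-mirror leaf       = refl
leftArm-mirror (node A B) = cong suc (leftArm-mirror B)

rightArm-mirror : ∀ t → rightArm (mirror t) ≡ leftArm t
rightArm-mirror leaf       = refl
rightArm-mirror (node A B) = cong suc (rightArm-mirror A)

inner-mirror : ∀ t → inner (mirror t) ≡ reverse (inner t)
inner-mirror leaf       = refl
inner-mirror (node A B) = begin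
    inner (mirror B) ++ (rightArm (mirror B) + suc (leftArm (mirror A))) ∷ inner (mirror A)
  ≡⟨ cong₂ (λ u v → u ++ v ∷ inner (mirror A)) (inner-mirror B)
       (cong₂ (λ a b → a + suc b) (rightArm-mirror B) (leftArm-mirror A)) ⟩
    reverse (inner B) ++ (leftArm B + suc (rightArm A)) ∷ inner (mirror A)
  ≡⟨ cong₂ (λ x v → reverse (inner B) ++ x ∷ v) apex (inner-mirror A) ⟩
    reverse (inner B) ++ apexA ∷ reverse (inner A)
  ≡⟨ cong (reverse (inner B) ++_) (sym (reverse-++ (inner A) [ apexA ])) ⟩
    reverse (inner B) ++ reverse (inner A ++ [ apexA ])
  ≡⟨ sym (reverse-++ (inner A ++ [ apexA ]) (inner B)) ⟩
    reverse ((inner A ++ [ apexA ]) ++ inner B)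
  ≡⟨ cong reverse (++-assoc (inner A) [ apexA ] (inner B)) ⟩
    reverse (inner (node A B))
  ∎
  where
  open ≡-Reasoning
  apexA : ℕ
  apexA = rightArm A + suc (leftArm B)
  apex : leftArm B + suc (rightArm A) ≡ apexA
  apex = trans (+-suc (leftArm B) (rightArm A))
           (trans (cong suc (+-comm (leftArm B) (rightArm A))) (sym (+-suc (rightArm A) (leftArm B))))

quiddity-mirror : ∀ t → quiddity (mirror t) ≡ reverse (quiddity t)
quiddity-mirror t = begin
    leftArm (mirror t) ∷ inner (mirror t) ++ [ rightArm (mirror t) ]
  ≡⟨ cong₂ (λ a u → a ∷ u ++ [ rightArm (mirror t) ]) (leftArm-mirror t) (inner-mirror t) ⟩
    rightArm t ∷ reverse (inner t) ++ [ rightArm (mirror t) ]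
  ≡⟨ cong (λ b → rightArm t ∷ reverse (inner t) ++ [ b ]) (rightArm-mirror t) ⟩
    (reverse [ rightArm t ] ++ reverse (inner t)) ++ [ leftArm t ]
  ≡⟨ cong (_++ [ leftArm t ]) (sym (reverse-++ (inner t) [ rightArm t ])) ⟩
    reverse (tailQ t) ++ [ leftArm t ]
  ≡⟨ sym (unfold-reverse (leftArm t) (tailQ t)) ⟩
    reverse (quiddity t)
  ∎
  where open ≡-Reasoning

-- Gluing the polygon X onto the edge following the left end of the marked edge.
graftLeft : Tree → Tree → Tree
graftLeft leaf       X = X
graftLeft (node A B) X = node (graftLeft A X) B

addHead : ℕ → List ℕ → List ℕ
addHead a []       = []
addHead a (x ∷ xs) = a + x ∷ xs

leftArm-graft : ∀ t X → leftArm (graftLeft t X) ≡ leftArm t + leftArm X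
leftArm-graft leaf       X = refl
leftArm-graft (node A B) X = cong suc (leftArm-graft A X)

-- Grafting stated for an arbitrary continuation (rightArm t + k) ∷ zs, so that
-- the induction passes through the right subtrees.
inner-graft : ∀ t X k zs →
  inner (graftLeft t X) ++ (rightArm (graftLeft t X) + k) ∷ zs
    ≡ inner X ++ addHead (rightArm X) (inner t ++ (rightArm t + k) ∷ zs)
inner-graft leaf       X k zs = refl
inner-graft (node A B) X k zs = begin
    (inner (graftLeft A X) ++ (rightArm (graftLeft A X) + suc (leftArm B)) ∷ inner B) ++ rest
  ≡⟨ ++-assoc (inner (graftLeft A X)) _ rest ⟩
    inner (graftLeft A X) ++ (rightArm (graftLeft A X) + suc (leftArm B)) ∷ (inner B ++ rest)
  ≡⟨ inner-graft A X (suc (leftArm B)) (inner B ++ rest) ⟩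
    inner X ++ addHead (rightArm X) (inner A ++ (rightArm A + suc (leftArm B)) ∷ (inner B ++ rest))
  ≡⟨ cong (λ u → inner X ++ addHead (rightArm X) u) (sym (++-assoc (inner A) _ rest)) ⟩
    inner X ++ addHead (rightArm X) (inner (node A B) ++ rest)
  ∎
  where
  open ≡-Reasoning
  rest : List ℕ
  rest = (suc (rightArm B) + k) ∷ zs

tailQ-graft : ∀ t X → tailQ (graftLeft t X) ≡ inner X ++ addHead (rightArm X) (tailQ t)
tailQ-graft t X = begin
    inner (graftLeft t X) ++ [ rightArm (graftLeft t X) ]
  ≡⟨ cong (λ a → inner (graftLeft t X) ++ [ a ]) (sym (+-identityʳ _)) ⟩
    inner (graftLeft t X) ++ [ rightArm (graftLeft t X) + 0 ]
  ≡⟨ inner-graft t X 0 [] ⟩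
    inner X ++ addHead (rightArm X) (inner t ++ [ rightArm t + 0 ])
  ≡⟨ cong (λ a → inner X ++ addHead (rightArm X) (inner t ++ [ a ])) (+-identityʳ _) ⟩
    inner X ++ addHead (rightArm X) (tailQ t)
  ∎
  where open ≡-Reasoning

quiddity-step : ∀ t c₁ c₂ rest → quiddity t ≡ c₁ ∷ c₂ ∷ rest →
  quiddity (graftLeft t (node leaf leaf)) ≡ suc c₁ ∷ 1 ∷ suc c₂ ∷ rest
quiddity-step t c₁ c₂ rest eq with leftArm≡ , tailQ≡ ← ∷-injective eq =
  cong₂ _∷_ (trans (leftArm-graft t (node leaf leaf)) (trans (+-comm (leftArm t) 1) (cong suc leftArm≡)))
            (trans (tailQ-graft t (node leaf leaf)) (cong (λ u → 1 ∷ addHead 1 u) tailQ≡))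

-- Moving the marked edge one step to the left rotates the quiddity by one.
rotateRoot : Tree → Tree
rotateRoot leaf       = leaf
rotateRoot (node A B) = graftLeft (rotateRoot B) (node leaf A)

quiddity-rotateRoot : ∀ t → quiddity (rotateRoot t) ≡ rightArm t ∷ leftArm t ∷ inner t
quiddity-rotateRoot leaf       = refl
quiddity-rotateRoot (node A B) with ∷-injective (quiddity-rotateRoot B)
... | leftArm≡ , tailQ≡ = cong₂ _∷_
  (trans (leftArm-graft (rotateRoot B) (node leaf A)) (trans (cong (_+ 1) leftArm≡) (+-comm (rightArm B) 1)))
  (begin
      tailQ (graftLeft (rotateRoot B) (node leaf A))
    ≡⟨ tailQ-graft (rotateRoot B) (node leaf A) ⟩
      suc (leftArm A) ∷ inner A ++ addHead (suc (rightArm A)) (tailQ (rotateRoot B))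
    ≡⟨ cong (λ u → suc (leftArm A) ∷ inner A ++ addHead (suc (rightArm A)) u) tailQ≡ ⟩
      suc (leftArm A) ∷ inner A ++ (suc (rightArm A) + leftArm B) ∷ inner B
    ≡⟨ cong (λ a → suc (leftArm A) ∷ inner A ++ a ∷ inner B) (sym (+-suc (rightArm A) (leftArm B))) ⟩
      leftArm (node A B) ∷ inner (node A B)
    ∎)
  where open ≡-Reasoning

quiddity-rotateRoot⁻¹ : ∀ t x xs → quiddity t ≡ x ∷ xs →
  quiddity (mirror (rotateRoot (mirror t))) ≡ xs ++ [ x ]
quiddity-rotateRoot⁻¹ t x xs eq = begin
    quiddity (mirror (rotateRoot (mirror t)))
  ≡⟨ quiddity-mirror (rotateRoot (mirror t)) ⟩
    reverse (quiddity (rotateRoot (mirror t)))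
  ≡⟨ cong reverse (quiddity-rotateRoot (mirror t)) ⟩
    reverse (rightArm (mirror t) ∷ leftArm (mirror t) ∷ inner (mirror t))
  ≡⟨ cong reverse (cong₂ _∷_ (rightArm-mirror t) (cong₂ _∷_ (leftArm-mirror t) (inner-mirror t))) ⟩
    reverse (leftArm t ∷ rightArm t ∷ reverse (inner t))
  ≡⟨ unfold-reverse (leftArm t) (rightArm t ∷ reverse (inner t)) ⟩
    reverse (rightArm t ∷ reverse (inner t)) ++ [ leftArm t ]
  ≡⟨ cong (_++ [ leftArm t ]) (unfold-reverse (rightArm t) (reverse (inner t))) ⟩
    (reverse (reverse (inner t)) ++ [ rightArm t ]) ++ [ leftArm t ]
  ≡⟨ cong (λ u → (u ++ [ rightArm t ]) ++ [ leftArm t ]) (reverse-involutive (inner t)) ⟩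
    tailQ t ++ [ leftArm t ]
  ≡⟨ cong₂ (λ u a → u ++ [ a ]) tailQ≡ leftArm≡ ⟩
    xs ++ [ x ]
  ∎
  where
  open ≡-Reasoning
  leftArm≡ = proj₁ (∷-injective eq)
  tailQ≡ = proj₂ (∷-injective eq)

quiddity-surjective : ∀ {w} → QuiddityCycle w → Σ Tree λ t → quiddity t ≡ w
quiddity-surjective base = leaf , refl
quiddity-surjective (step c₁ c₂ rest q) with t , eq ← quiddity-surjective q =
  graftLeft t (node leaf leaf) , quiddity-step t c₁ c₂ rest eq
quiddity-surjective (rotate x xs q) with t , eq ← quiddity-surjective q =
  mirror (rotateRoot (mirror t)) , quiddity-rotateRoot⁻¹ t x xs eq
quiddity-surjective (rev xs q) with t , eq ← quiddity-surjective q =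
  mirror t , trans (quiddity-mirror t) (cong reverse eq)

Occurs : List ℕ → List ℕ → Set
Occurs = Infix _≡_

HasPattern : List ℕ → Set
HasPattern s = Any (λ w → Occurs w s ⊎ Occurs (reverse w) s) patterns

hasPattern? : ∀ s → Dec (HasPattern s)
hasPattern? s = any? (λ w → infix? _≟_ w s ⊎-dec infix? _≟_ (reverse w) s) patterns

pattern-++ˡ : ∀ xs {s} → HasPattern s → HasPattern (xs ++ s)
pattern-++ˡ xs = Any.map (map⊎ (xs ++ⁱ_) (xs ++ⁱ_))

pattern-++ʳ : ∀ {s} → HasPattern s → ∀ ys → HasPattern (s ++ ys)
pattern-++ʳ p ys = Any.map (map⊎ (_ⁱ++ ys) (_ⁱ++ ys)) p

node-injective : ∀ {A A′ B B′} → node A B ≡ node A′ B′ → A ≡ A′ × B ≡ B′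
node-injective refl = refl , refl

_≟ᵀ_ : DecidableEquality Tree
leaf     ≟ᵀ leaf       = yes refl
leaf     ≟ᵀ node _ _   = no λ ()
node _ _ ≟ᵀ leaf       = no λ ()
node A B ≟ᵀ node A′ B′ = map′ (λ (p , q) → cong₂ node p q) node-injective (A ≟ᵀ A′ ×-dec B ≟ᵀ B′)

smallTrees : List Tree
smallTrees = leaf ∷ node leaf leaf ∷ node (node leaf leaf) leaf ∷ node leaf (node leaf leaf)
           ∷ node (node leaf leaf) (node leaf leaf) ∷ []

SmallOrPatternTree : Tree → Set
SmallOrPatternTree t = t ∈ smallTrees ⊎ HasPattern (inner t)

smallOrPatternTree? : ∀ t → Dec (SmallOrPatternTree t)
smallOrPatternTree? t = _∈?_ _≟ᵀ_ t smallTrees ⊎-dec hasPattern? (inner t)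

joinSmallTrees : All (λ A → All (λ B → SmallOrPatternTree (node A B)) smallTrees) smallTrees
joinSmallTrees = from-yes (all? (λ A → all? (λ B → smallOrPatternTree? (node A B)) smallTrees) smallTrees)

smallOrPatternTree : ∀ t → SmallOrPatternTree t
smallOrPatternTree leaf = inj₁ (here refl)
smallOrPatternTree (node A B) with smallOrPatternTree A | smallOrPatternTree B
... | inj₂ p | _      = inj₂ (pattern-++ʳ p _)
... | inj₁ _ | inj₂ p = inj₂ (pattern-++ˡ (inner A) (pattern-++ˡ [ rightArm A + suc (leftArm B) ] p))
... | inj₁ a | inj₁ b = All.lookup (All.lookup joinSmallTrees a) b

treeBlock : Tree → Block
treeBlock t = block (leftArm t) (inner t) (rightArm t)

blockList-injective : ∀ {b b′} → blockList b ≡ blockList b′ → b ≡ b′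
blockList-injective {block f m l} {block f′ m′ l′} eq
  with refl , tail≡ ← ∷-injective eq
  with refl , refl ← ∷ʳ-injective m m′ tail≡ = refl

smallBlocks : List Block
smallBlocks = map treeBlock smallTrees

SmallOrPattern : Block → Set
SmallOrPattern b = b ∈ smallBlocks ⊎ HasPattern (middle b)

smallOrPatternBlock : ∀ b → QuiddityCycle (blockList b) → SmallOrPattern b
smallOrPatternBlock b q with t , eq ← quiddity-surjective q
  with refl ← blockList-injective {treeBlock t} {b} eq =
  map₁ (∈-map⁺ treeBlock) (smallOrPatternTree t)

-- The values of an affine sequence covered by consecutive blocks: the inner
-- entries of each block, separated by the merged junction entries.
window : List Block → List ℕ
window []            = []
window (b ∷ [])      = middle b
window (b ∷ b′ ∷ bs) = middle b ++ (final b + 2 + first b′) ∷ window (b′ ∷ bs)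

windowSmallOrPattern : ∀ bs → All SmallOrPattern bs → All (_∈ smallBlocks) bs ⊎ HasPattern (window bs)
windowSmallOrPattern [] [] = inj₁ []
windowSmallOrPattern (b ∷ []) (inj₁ s ∷ []) = inj₁ (s ∷ [])
windowSmallOrPattern (b ∷ []) (inj₂ p ∷ []) = inj₂ p
windowSmallOrPattern (b ∷ b′ ∷ bs) (inj₂ p ∷ _) = inj₂ (pattern-++ʳ p _)
windowSmallOrPattern (b ∷ b′ ∷ bs) (inj₁ s ∷ rest) with windowSmallOrPattern (b′ ∷ bs) rest
... | inj₁ smalls = inj₁ (s ∷ smalls)
... | inj₂ p      = inj₂ (pattern-++ˡ (middle b) (pattern-++ˡ [ final b + 2 + first b′ ] p))

-- Finite check: every window of five small blocks contains a pattern.  The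
-- window must span several blocks since the 2-gon block (0,0) has no inner entry.
smallWindows : All (λ b₀ → All (λ b₁ → All (λ b₂ → All (λ b₃ → All (λ b₄ →
  HasPattern (window (b₀ ∷ b₁ ∷ b₂ ∷ b₃ ∷ b₄ ∷ [])))
  smallBlocks) smallBlocks) smallBlocks) smallBlocks) smallBlocks
smallWindows = from-yes (all? (λ b₀ → all? (λ b₁ → all? (λ b₂ → all? (λ b₃ → all? (λ b₄ →
  hasPattern? (window (b₀ ∷ b₁ ∷ b₂ ∷ b₃ ∷ b₄ ∷ [])))
  smallBlocks) smallBlocks) smallBlocks) smallBlocks) smallBlocks)

fiveBlocksPattern : ∀ b₀ b₁ b₂ b₃ b₄ → All SmallOrPattern (b₀ ∷ b₁ ∷ b₂ ∷ b₃ ∷ b₄ ∷ []) →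
  HasPattern (window (b₀ ∷ b₁ ∷ b₂ ∷ b₃ ∷ b₄ ∷ []))
fiveBlocksPattern b₀ b₁ b₂ b₃ b₄ sp with windowSmallOrPattern _ sp
... | inj₂ p = p
... | inj₁ (s₀ ∷ s₁ ∷ s₂ ∷ s₃ ∷ s₄ ∷ []) =
  All.lookup (All.lookup (All.lookup (All.lookup (All.lookup smallWindows s₀) s₁) s₂) s₃) s₄

Reads : (ℤ → ℤ) → ℤ → List ℕ → Set
Reads c i []       = ⊤
Reads c i (x ∷ xs) = c i ≡ + x × Reads c (i +ℤ 1ℤ) xs

shift : ∀ i n → (i +ℤ 1ℤ) +ℤ + n ≡ i +ℤ + suc n
shift i n = ℤ.+-assoc i 1ℤ (+ n)

reads-++ : ∀ {c} i xs {ys} → Reads c i xs → Reads c (i +ℤ + length xs) ys → Reads c i (xs ++ ys)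
reads-++ {c} i []       {ys} _          r = subst (λ j → Reads c j ys) (ℤ.+-identityʳ i) r
reads-++ {c} i (x ∷ xs) {ys} (cx , rxs) r =
  cx , reads-++ (i +ℤ 1ℤ) xs rxs (subst (λ j → Reads c j ys) (sym (shift i (length xs))) r)

reads-tabulated : ∀ {c} i xs → (∀ (k : Fin (length xs)) → c (i +ℤ + suc (toℕ k)) ≡ + lookup xs k)
                → Reads c (i +ℤ 1ℤ) xs
reads-tabulated i []       _ = tt
reads-tabulated {c} i (x ∷ xs) h =
  h fzero , reads-tabulated (i +ℤ 1ℤ) xs (λ k → trans (cong c (shift i (suc (toℕ k)))) (h (fsuc k)))

reads⇒containsAt : ∀ {c} i w → Reads c i w → ContainsAt c w i
reads⇒containsAt {c} i (x ∷ w) (cx , r) fzero    = trans (cong c (ℤ.+-identityʳ i)) cx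
reads⇒containsAt {c} i (x ∷ w) (cx , r) (fsuc k) =
  trans (cong c (sym (shift i (toℕ k)))) (reads⇒containsAt (i +ℤ 1ℤ) w r k)

reads-prefix : ∀ {c i w s} → Prefix _≡_ w s → Reads c i s → Reads c i w
reads-prefix []           _        = tt
reads-prefix (refl ∷ pre) (cx , r) = cx , reads-prefix pre r

occurs⇒contains : ∀ {c i w s} → Occurs w s → Reads c i s → Contains c w
occurs⇒contains {i = i} (here pre)  r       = i , reads⇒containsAt i _ (reads-prefix pre r)
occurs⇒contains         (there occ) (_ , r) = occurs⇒contains occ r

reads-pattern : ∀ {c i s} → Reads c i s → HasPattern s →
  Σ (List ℕ) λ w → (w ∈ patterns) × (Contains c w ⊎ Contains c (reverse w))
reads-pattern r p with w , w∈ , occ ← find p =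
  w , w∈ , map⊎ (λ o → occurs⇒contains o r) (λ o → occurs⇒contains o r) occ

module AffineWindows {c : ℤ → ℤ} (A : AffineWitness c) where
  open AffineWitness A renaming (inner to innerValues)

  blocksFrom : ℤ → ℕ → List Block
  blocksFrom k zero    = []
  blocksFrom k (suc n) = blk k ∷ blocksFrom (sucℤ k) n

  blocksSmallOrPattern : ∀ k n → All SmallOrPattern (blocksFrom k n)
  blocksSmallOrPattern k zero    = []
  blocksSmallOrPattern k (suc n) = smallOrPatternBlock (blk k) (isQC k) ∷ blocksSmallOrPattern (sucℤ k) n

  reads-middle : ∀ k → Reads c (pos k +ℤ 1ℤ) (middle (blk k))
  reads-middle k = reads-tabulated (pos k) (middle (blk k)) (innerValues k)

  pos-after-middle : ∀ k → (pos k +ℤ 1ℤ) +ℤ + length (middle (blk k)) ≡ pos (sucℤ k)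
  pos-after-middle k = trans (shift (pos k) (length (middle (blk k)))) (sym (posStep k))

  junction-after : ∀ k → c (pos (sucℤ k)) ≡ + (final (blk k) + 2 + first (blk (sucℤ k)))
  junction-after k =
    subst (λ k′ → c (pos (sucℤ k)) ≡ + (final (blk k′) + 2 + first (blk (sucℤ k)))) (ℤ.pred-suc k)
      (junction (sucℤ k))

  reads-window : ∀ n k → Reads c (pos k +ℤ 1ℤ) (window (blocksFrom k (suc n)))
  reads-window zero    k = reads-middle k
  reads-window (suc n) k = reads-++ (pos k +ℤ 1ℤ) (middle (blk k)) (reads-middle k)
    (subst (λ j → Reads c j (final (blk k) + 2 + first (blk (sucℤ k)) ∷ window (blocksFrom (sucℤ k) (suc n))))
      (sym (pos-after-middle k))
      (junction-after k , reads-window n (sucℤ k)))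

corollary4p3 : (c : ℤ → ℤ) → Affine c →
  Σ (List ℕ) λ w → (w ∈ patterns) × (Contains c w ⊎ Contains c (reverse w))
corollary4p3 c A = reads-pattern (reads-window 4 0ℤ) windowPattern
  where
  open AffineWindows A
  windowPattern : HasPattern (window (blocksFrom 0ℤ 5))
  windowPattern = fiveBlocksPattern _ _ _ _ _ (blocksSmallOrPattern 0ℤ 5)
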